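{- Let $T$ be a rooted tree of order $n\ge 2$ with $\ell$ leaves and $s$ support vertices. Then $$s\le \rho(T)\le \left\lceil \frac{n-\ell+s}{2}\right\rceil.$$
   Context: A rooted tree is a connected digraph having a vertex of in-degree $0$ (the root) such that every other vertex has in-degree $1$. A leaf is a vertex of out-degree $0$, and a support vertex is a vertex that is the in-neighbor of some leaf. For a vertex $v$, $N^+[v]=\{v\}\cup\{u:(v,u)\text{ is an arc}\}$. A set $B$ of vertices is a packing if $|N^+[v]\cap B|\le 1$ for every vertex $v$; $\rho(T)$ is the maximum size of a packing in $T$. -}

module Defs where

open import Data.Nat using (ℕ; zero; suc; _≤_)
open import Data.Fin using (Fin)
open import Data.Fin.Properties using (_≟_)
open import Data.Fin.Subset using (Subset; ∣_∣; _∩_)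
open import Data.Vec using (tabulate)
open import Data.Bool using (Bool; not; _∧_; _∨_)
open import Data.Bool.ListAction using (any)
open import Data.List using (allFin)
open import Data.Product using (Σ; _×_; ∃)
open import Relation.Binary.PropositionalEquality using (_≡_; _≢_)
open import Relation.Nullary using (does)

-- A rooted tree on vertex set Fin n, encoded by a root and a parent map.  The conditions say that
-- the root has in-degree 0, every other vertex in-degree 1, and every vertex
-- is reached from the root (equivalently: iterating par reaches the root).
iter : ∀ {n} → (Fin n → Fin n) → ℕ → Fin n → Fin n
iter f zero    v = v
iter f (suc k) v = f (iter f k v)

record RootedTree (n : ℕ) : Set where
  field
    root    : Fin n
    par     : Fin n → Fin n
    reaches : ∀ v → ∃ λ k → iter par k v ≡ root

  Arc : Fin n → Fin n → Set
  Arc u v = (v ≢ root) × (par v ≡ u)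

  arc? : Fin n → Fin n → Bool
  arc? u v = not (does (v ≟ root)) ∧ does (par v ≟ u)

  N⁺[_] : Fin n → Subset n
  N⁺[ v ] = tabulate λ u → does (u ≟ v) ∨ arc? v u

  isLeaf : Fin n → Bool
  isLeaf v = not (any (arc? v) (allFin n))

  isSupport : Fin n → Bool
  isSupport v = any (λ u → arc? v u ∧ isLeaf u) (allFin n)

  Leaves : Subset n
  Leaves = tabulate isLeaf

  Supports : Subset n
  Supports = tabulate isSupport

  ℓ : ℕ
  ℓ = ∣ Leaves ∣

  s : ℕ
  s = ∣ Supports ∣

  IsPacking : Subset n → Set
  IsPacking B = ∀ v → ∣ N⁺[ v ] ∩ B ∣ ≤ 1

  IsPackingNumber : ℕ → Set
  IsPackingNumber k = (Σ (Subset n) λ B → IsPacking B × ∣ B ∣ ≡ k)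
                    × (∀ B → IsPacking B → ∣ B ∣ ≤ k)

-- Lower bound: pick one leaf child of every support vertex.  These leaves form a
-- packing, since a chosen leaf has no children and any other closed
-- neighbourhood N⁺[v] contains at most the one leaf chosen for v; so ρ ≥ s.
-- Upper bound: for a packing B every vertex w satisfies [w ∈ B] + c(w) ≤ 1,
-- where c(w) counts the children of w in B.  Every vertex of B except possibly
-- the root is counted once as a child, so 2|B| ≤ 1 + Σ_w ([w ∈ B] + c(w)).
-- A non-leaf contributes at most 1 and a leaf only [w ∈ B]; finally the leaves
-- in B have pairwise distinct parents (siblings share a neighbourhood), all of
-- them support vertices, so there are at most s of them.  Hence
-- 2|B| ≤ 1 + (n − ℓ) + s, i.e. |B| ≤ ⌈(n − ℓ + s)/2⌉.

module Submission where

open import Defs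
open import Data.Nat using (ℕ; zero; suc; _+_; _∸_; _≤_; z≤n; s≤s; ⌈_/2⌉)
open import Data.Nat.Properties
  using (+-0-commutativeMonoid; ≤-refl; ≤-trans; ≤-reflexive; ≤-antisym; module ≤-Reasoning;
         +-mono-≤; +-monoˡ-≤; +-monoʳ-≤; m≤m+n; m≤n+m; +-identityʳ; +-suc; m+n∸m≡n;
         ⌊n/2⌋-mono; n≡⌊n+n/2⌋)
open import Data.Bool using (Bool; true; false; not; _∧_; _∨_; T)
open import Data.Bool.Properties using (∧-distribʳ-∨; ∧-identityʳ; ∨-identityʳ; T-∧; T-≡; T-not-≡)
open import Data.Fin using (Fin; zero; suc)
open import Data.Fin.Properties using (_≟_; suc-injective; 0≢1+n; any?)
open import Data.Fin.Subset using (Subset; ∣_∣; _∩_)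
open import Data.Vec using ([]; _∷_; lookup; tabulate)
open import Data.Vec.Properties using (lookup∘tabulate; lookup-zipWith)
open import Data.Product using (_×_; _,_; ∃; proj₁; proj₂)
open import Data.Empty using (⊥-elim)
open import Data.Maybe using (Maybe; just; nothing)
open import Data.Maybe.Properties using (≡-dec; just-injective)
open import Data.List using (allFin)
open import Data.List.Relation.Unary.Any using (satisfied)
open import Data.List.Relation.Unary.Any.Properties using (any⁺; any⁻)
open import Data.List.Membership.Propositional using (lose)
open import Data.List.Membership.Propositional.Properties using (∈-allFin)
open import Function using (_∘_; Equivalence)
open import Relation.Binary.PropositionalEquality
  using (_≡_; _≢_; refl; sym; trans; cong; subst; module ≡-Reasoning)
open import Relation.Nullary using (¬_; Dec; does; yes; no)
open import Relation.Nullary.Decidable using (dec-true; T?)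
open import Algebra.Properties.CommutativeMonoid.Sum +-0-commutativeMonoid
  using (sum-syntax; ∑-comm; ∑-distrib-+; sum-cong-≗; sum-replicate-zero)

open Equivalence using (to; from)

does⁺ : ∀ {a} {A : Set a} (a? : Dec A) → A → T (does a?)
does⁺ (yes _) _ = _
does⁺ (no ¬a) a = ¬a a

does⁻ : ∀ {a} {A : Set a} (a? : Dec A) → T (does a?) → A
does⁻ (yes a) _ = a

not-does⁺ : ∀ {a} {A : Set a} (a? : Dec A) → ¬ A → T (not (does a?))
not-does⁺ (yes a) ¬a = ¬a a
not-does⁺ (no _)  _  = _

not-does⁻ : ∀ {a} {A : Set a} (a? : Dec A) → T (not (does a?)) → ¬ A
not-does⁻ (no ¬a) _ = ¬a

⟦_⟧ : Bool → ℕ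
⟦ true ⟧  = 1
⟦ false ⟧ = 0

⟦⟧≤1 : ∀ b → ⟦ b ⟧ ≤ 1
⟦⟧≤1 true  = ≤-refl
⟦⟧≤1 false = z≤n

T⇒⟦⟧≡1 : ∀ {b} → T b → ⟦ b ⟧ ≡ 1
T⇒⟦⟧≡1 {true} _ = refl

¬T⇒⟦⟧≡0 : ∀ {b} → ¬ T b → ⟦ b ⟧ ≡ 0
¬T⇒⟦⟧≡0 {true}  ¬t = ⊥-elim (¬t _)
¬T⇒⟦⟧≡0 {false} _  = refl

∑-mono-≤ : ∀ {n} {f g : Fin n → ℕ} → (∀ i → f i ≤ g i) → ∑[ i < n ] f i ≤ ∑[ i < n ] g i
∑-mono-≤ {zero}  f≤g = z≤n
∑-mono-≤ {suc n} f≤g = +-mono-≤ (f≤g zero) (∑-mono-≤ (f≤g ∘ suc))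

term≤∑ : ∀ {n} (f : Fin n → ℕ) i → f i ≤ ∑[ j < n ] f j
term≤∑ f zero    = m≤m+n _ _
term≤∑ f (suc i) = ≤-trans (term≤∑ (f ∘ suc) i) (m≤n+m _ _)

count : ∀ {n} → (Fin n → Bool) → ℕ
count {n} p = ∑[ i < n ] ⟦ p i ⟧

∣p∣≡count : ∀ {n} (p : Subset n) → ∣ p ∣ ≡ count (lookup p)
∣p∣≡count []          = refl
∣p∣≡count (true ∷ p)  = cong suc (∣p∣≡count p)
∣p∣≡count (false ∷ p) = ∣p∣≡count p

∣tabulate∣≡count : ∀ {n} (p : Fin n → Bool) → ∣ tabulate p ∣ ≡ count p
∣tabulate∣≡count p = trans (∣p∣≡count (tabulate p)) (sum-cong-≗ (cong ⟦_⟧ ∘ lookup∘tabulate p))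

∣tabulate∩∣≡count : ∀ {n} (p : Fin n → Bool) (q : Subset n) →
                    ∣ tabulate p ∩ q ∣ ≡ count (λ i → p i ∧ lookup q i)
∣tabulate∩∣≡count p q = trans (∣p∣≡count (tabulate p ∩ q)) (sum-cong-≗ λ i →
  cong ⟦_⟧ (trans (lookup-zipWith _∧_ i (tabulate p) q) (cong (_∧ lookup q i) (lookup∘tabulate p i))))

count-true : ∀ n → count {n} (λ _ → true) ≡ n
count-true zero    = refl
count-true (suc n) = cong suc (count-true n)

count-mono : ∀ {n} {p q : Fin n → Bool} → (∀ i → T (p i) → T (q i)) → count p ≤ count q
count-mono p⇒q = ∑-mono-≤ λ i → ⟦⟧-mono (p⇒q i)
  where
  ⟦⟧-mono : ∀ {a b} → (T a → T b) → ⟦ a ⟧ ≤ ⟦ b ⟧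
  ⟦⟧-mono {false}         _   = z≤n
  ⟦⟧-mono {true} {true}   _   = ≤-refl
  ⟦⟧-mono {true} {false}  a⇒b = ⊥-elim (a⇒b _)

T⇒1≤count : ∀ {n} (p : Fin n → Bool) {i} → T (p i) → 1 ≤ count p
T⇒1≤count p {i} t = ≤-trans (≤-reflexive (sym (T⇒⟦⟧≡1 t))) (term≤∑ (⟦_⟧ ∘ p) i)

count≡0 : ∀ {n} {p : Fin n → Bool} → (∀ i → ¬ T (p i)) → count p ≡ 0
count≡0 {n} ¬p = trans (sum-cong-≗ (¬T⇒⟦⟧≡0 ∘ ¬p)) (sum-replicate-zero n)

count≤1 : ∀ {n} (p : Fin n → Bool) → (∀ i j → T (p i) → T (p j) → i ≡ j) → count p ≤ 1
count≤1 {zero}  p unique = z≤n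
count≤1 {suc n} p unique with p zero in p₀
... | true  = ≤-reflexive (cong suc (count≡0 λ i t → 0≢1+n (unique zero (suc i) (from T-≡ p₀) t)))
... | false = count≤1 (p ∘ suc) λ i j tᵢ tⱼ → suc-injective (unique (suc i) (suc j) tᵢ tⱼ)

count-unique : ∀ {n} (p : Fin n → Bool) a → (∀ i → T (p i) → i ≡ a) → count p ≡ ⟦ p a ⟧
count-unique p a only-a with p a in pₐ
... | true  = ≤-antisym (count≤1 p λ i j tᵢ tⱼ → trans (only-a i tᵢ) (sym (only-a j tⱼ)))
                        (T⇒1≤count p (from T-≡ pₐ))
... | false = count≡0 λ i t → subst T (trans (cong p (only-a i t)) pₐ) t

count-∨-disjoint : ∀ {n} (p q : Fin n → Bool) → (∀ i → T (p i) → ¬ T (q i)) →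
                   count (λ i → p i ∨ q i) ≡ count p + count q
count-∨-disjoint p q disjoint = trans (sum-cong-≗ λ i → ⟦∨⟧ (disjoint i)) (∑-distrib-+ (⟦_⟧ ∘ p) (⟦_⟧ ∘ q))
  where
  ⟦∨⟧ : ∀ {a b} → (T a → ¬ T b) → ⟦ a ∨ b ⟧ ≡ ⟦ a ⟧ + ⟦ b ⟧
  ⟦∨⟧ {true}  {true}  a⇒¬b = ⊥-elim (a⇒¬b _ _)
  ⟦∨⟧ {true}  {false} _    = refl
  ⟦∨⟧ {false}         _    = refl

count-not : ∀ {n} (p : Fin n → Bool) → count (not ∘ p) ≡ n ∸ count p
count-not {n} p = begin
  count (not ∘ p)                                ≡⟨ m+n∸m≡n (count p) _ ⟨
  count p + count (not ∘ p) ∸ count p            ≡⟨ cong (_∸ count p) (∑-distrib-+ (⟦_⟧ ∘ p) (⟦_⟧ ∘ not ∘ p)) ⟨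
  ∑[ i < n ] (⟦ p i ⟧ + ⟦ not (p i) ⟧) ∸ count p ≡⟨ cong (_∸ count p) (sum-cong-≗ (⟦⟧+⟦not⟧ ∘ p)) ⟩
  count {n} (λ _ → true) ∸ count p               ≡⟨ cong (_∸ count p) (count-true n) ⟩
  n ∸ count p                                    ∎
  where
  open ≡-Reasoning
  ⟦⟧+⟦not⟧ : ∀ b → ⟦ b ⟧ + ⟦ not b ⟧ ≡ 1
  ⟦⟧+⟦not⟧ true  = refl
  ⟦⟧+⟦not⟧ false = refl

count-at : ∀ {n} (p : Fin n → Bool) a → count (λ i → does (i ≟ a) ∧ p i) ≡ ⟦ p a ⟧
count-at p a = trans (count-unique _ a λ i t → does⁻ (i ≟ a) (proj₁ (to T-∧ t)))
                     (cong (λ d → ⟦ d ∧ p a ⟧) (dec-true (a ≟ a) refl))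

count-split : ∀ {n} (p : Fin n → Bool) a → count p ≡ ⟦ p a ⟧ + count (λ i → not (does (i ≟ a)) ∧ p i)
count-split p a = begin
  count p
    ≡⟨ sum-cong-≗ (λ i → cong ⟦_⟧ (split-on (does (i ≟ a)) (p i))) ⟩
  count (λ i → (does (i ≟ a) ∧ p i) ∨ (not (does (i ≟ a)) ∧ p i))
    ≡⟨ count-∨-disjoint _ _ (λ i t t′ → not-does⁻ (i ≟ a) (proj₁ (to T-∧ t′))
                                                   (does⁻ (i ≟ a) (proj₁ (to T-∧ t)))) ⟩
  count (λ i → does (i ≟ a) ∧ p i) + count (λ i → not (does (i ≟ a)) ∧ p i)
    ≡⟨ cong (_+ count (λ i → not (does (i ≟ a)) ∧ p i)) (count-at p a) ⟩
  ⟦ p a ⟧ + count (λ i → not (does (i ≟ a)) ∧ p i) ∎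
  where
  open ≡-Reasoning
  split-on : ∀ d x → x ≡ (d ∧ x) ∨ (not d ∧ x)
  split-on true  x = sym (∨-identityʳ x)
  split-on false x = refl

∃≢ : ∀ {n} → 2 ≤ n → (a : Fin n) → ∃ λ b → b ≢ a
∃≢ (s≤s (s≤s _)) zero    = suc zero , λ ()
∃≢ (s≤s (s≤s _)) (suc _) = zero , λ ()

2k≤1+m⇒k≤⌈m/2⌉ : ∀ {k m} → k + k ≤ suc m → k ≤ ⌈ m /2⌉
2k≤1+m⇒k≤⌈m/2⌉ {k} h = ≤-trans (≤-reflexive (n≡⌊n+n/2⌋ k)) (⌊n/2⌋-mono h)

module _ {n : ℕ} (tree : RootedTree n) where
  open RootedTree tree

  nonRoot : Fin n → Bool
  nonRoot v = not (does (v ≟ root))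

  arc?⇒Arc : ∀ {u v} → T (arc? u v) → Arc u v
  arc?⇒Arc {u} {v} t = let nonroot , parent = to T-∧ t in
    not-does⁻ (v ≟ root) nonroot , does⁻ (par v ≟ u) parent

  Arc⇒arc? : ∀ {u v} → Arc u v → T (arc? u v)
  Arc⇒arc? {u} {v} (v≢root , pv≡u) =
    from T-∧ (not-does⁺ (v ≟ root) v≢root , does⁺ (par v ≟ u) pv≡u)

  arc?-par : ∀ v → arc? (par v) v ≡ nonRoot v
  arc?-par v = trans (cong (nonRoot v ∧_) (dec-true (par v ≟ par v) refl)) (∧-identityʳ _)

  fixed⇒root : ∀ {v} → par v ≡ v → v ≡ root
  fixed⇒root {v} pv≡v = let k , reach = reaches v in trans (sym (iter-fixed k)) reach
    where
    iter-fixed : ∀ k → iter par k v ≡ v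
    iter-fixed zero    = refl
    iter-fixed (suc k) = trans (cong par (iter-fixed k)) pv≡v

  ¬Arc-self : ∀ v → ¬ Arc v v
  ¬Arc-self v (v≢root , pv≡v) = v≢root (fixed⇒root pv≡v)

  root-has-child : 2 ≤ n → ∃ (Arc root)
  root-has-child 2≤n = let v , v≢root = ∃≢ 2≤n root
                           k , reach  = reaches v
                       in path k v≢root reach
    where
    path : ∀ k {v} → v ≢ root → iter par k v ≡ root → ∃ (Arc root)
    path zero    v≢root reach = ⊥-elim (v≢root reach)
    path (suc k) {v} v≢root reach with iter par k v ≟ root
    ... | yes reach′ = path k v≢root reach′
    ... | no  w≢root = iter par k v , w≢root , reach

  leaf⇒¬arc? : ∀ {v u} → T (isLeaf v) → ¬ T (arc? v u)
  leaf⇒¬arc? {v} {u} leaf arc = subst T (to T-not-≡ leaf) (any⁺ (arc? v) (lose (∈-allFin u) arc))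

  leaf⇒nonRoot : 2 ≤ n → ∀ {v} → T (isLeaf v) → T (nonRoot v)
  leaf⇒nonRoot 2≤n {v} leaf = not-does⁺ (v ≟ root) λ { refl →
    let w , root→w = root-has-child 2≤n in leaf⇒¬arc? leaf (Arc⇒arc? root→w) }

  support⇒leafChild : ∀ {p} → T (isSupport p) → ∃ λ u → T (arc? p u ∧ isLeaf u)
  support⇒leafChild {p} supp = satisfied (any⁻ (λ u → arc? p u ∧ isLeaf u) (allFin n) supp)

  leafChild⇒support : ∀ {p u} → T (arc? p u ∧ isLeaf u) → T (isSupport p)
  leafChild⇒support {u = u} t = any⁺ _ (lose (∈-allFin u) t)

  childCount : Fin n → (Fin n → Bool) → ℕ
  childCount v q = count (λ u → arc? v u ∧ q u)

  ∑-childCount : ∀ q → ∑[ p < n ] childCount p q ≡ count (λ u → nonRoot u ∧ q u)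
  ∑-childCount q = begin
    ∑[ p < n ] ∑[ u < n ] ⟦ arc? p u ∧ q u ⟧  ≡⟨ ∑-comm (λ p u → ⟦ arc? p u ∧ q u ⟧) ⟩
    ∑[ u < n ] count (λ p → arc? p u ∧ q u)   ≡⟨ sum-cong-≗ (λ u → count-unique _ (par u) λ p t →
                                                     sym (proj₂ (arc?⇒Arc (proj₁ (to T-∧ t))))) ⟩
    ∑[ u < n ] ⟦ arc? (par u) u ∧ q u ⟧       ≡⟨ sum-cong-≗ (λ u → cong (λ b → ⟦ b ∧ q u ⟧) (arc?-par u)) ⟩
    count (λ u → nonRoot u ∧ q u)             ∎
    where open ≡-Reasoning

  childCount-mono : ∀ v {q r} → (∀ u → T (q u) → T (r u)) → childCount v q ≤ childCount v r
  childCount-mono v q⇒r = count-mono λ u t → let arc , qu = to T-∧ t in from T-∧ (arc , q⇒r u qu)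

  leaf⇒childCount≡0 : ∀ {v} → T (isLeaf v) → ∀ q → childCount v q ≡ 0
  leaf⇒childCount≡0 {v} leaf q =
    count≡0 {p = λ u → arc? v u ∧ q u} λ u t → leaf⇒¬arc? {u = u} leaf (proj₁ (to T-∧ t))

  ∣N⁺∩∣≡self+children : ∀ v (B : Subset n) → ∣ N⁺[ v ] ∩ B ∣ ≡ ⟦ lookup B v ⟧ + childCount v (lookup B)
  ∣N⁺∩∣≡self+children v B = begin
    ∣ N⁺[ v ] ∩ B ∣
      ≡⟨ ∣tabulate∩∣≡count _ B ⟩
    count (λ u → (does (u ≟ v) ∨ arc? v u) ∧ b u)
      ≡⟨ sum-cong-≗ (λ u → cong ⟦_⟧ (∧-distribʳ-∨ (b u) (does (u ≟ v)) (arc? v u))) ⟩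
    count (λ u → (does (u ≟ v) ∧ b u) ∨ (arc? v u ∧ b u))
      ≡⟨ count-∨-disjoint _ _ disjoint ⟩
    count (λ u → does (u ≟ v) ∧ b u) + childCount v b
      ≡⟨ cong (_+ childCount v b) (count-at b v) ⟩
    ⟦ b v ⟧ + childCount v b ∎
    where
    open ≡-Reasoning
    b = lookup B
    disjoint : ∀ u → T (does (u ≟ v) ∧ b u) → ¬ T (arc? v u ∧ b u)
    disjoint u self arc with refl ← does⁻ (u ≟ v) (proj₁ (to T-∧ self)) =
      ¬Arc-self u (arc?⇒Arc (proj₁ (to T-∧ arc)))

  module _ {B : Subset n} (packing : IsPacking B) where

    private
      b : Fin n → Bool
      b = lookup B

    self+children≤1 : ∀ v → ⟦ b v ⟧ + childCount v b ≤ 1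
    self+children≤1 v = subst (_≤ 1) (∣N⁺∩∣≡self+children v B) (packing v)

    self+children≤nonLeaf+leafInB : ∀ w →
      ⟦ b w ⟧ + childCount w b ≤ ⟦ not (isLeaf w) ⟧ + ⟦ isLeaf w ∧ b w ⟧
    self+children≤nonLeaf+leafInB w with isLeaf w in leaf
    ... | true  = ≤-reflexive (trans (cong (⟦ b w ⟧ +_) (leaf⇒childCount≡0 (from T-≡ leaf) b))
                                     (+-identityʳ _))
    ... | false = self+children≤1 w

    leafChildren≤support : ∀ p → childCount p (λ u → isLeaf u ∧ b u) ≤ ⟦ isSupport p ⟧
    leafChildren≤support p with isSupport p in supp
    ... | true  = ≤-trans (childCount-mono p λ u → proj₂ ∘ to (T-∧ {isLeaf u}))
                          (≤-trans (m≤n+m _ _) (self+children≤1 p))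
    ... | false = ≤-reflexive (count≡0 {p = λ u → arc? p u ∧ (isLeaf u ∧ b u)} λ u t →
                    let arc , leaf∧bu = to (T-∧ {arc? p u}) t
                        leaf          = proj₁ (to (T-∧ {isLeaf u}) leaf∧bu)
                    in subst T supp (leafChild⇒support {u = u} (from T-∧ (arc , leaf))))

    leaves∩B≤s : 2 ≤ n → count (λ w → isLeaf w ∧ b w) ≤ s
    leaves∩B≤s 2≤n = begin
      count (λ w → isLeaf w ∧ b w)                      ≤⟨ count-mono leaf∧b⇒nonRoot ⟩
      count (λ w → nonRoot w ∧ (isLeaf w ∧ b w))        ≡⟨ ∑-childCount (λ w → isLeaf w ∧ b w) ⟨
      ∑[ p < n ] childCount p (λ w → isLeaf w ∧ b w)    ≤⟨ ∑-mono-≤ leafChildren≤support ⟩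
      count isSupport                                   ≡⟨ ∣tabulate∣≡count isSupport ⟨
      s                                                 ∎
      where
      open ≤-Reasoning
      leaf∧b⇒nonRoot : ∀ w → T (isLeaf w ∧ b w) → T (nonRoot w ∧ (isLeaf w ∧ b w))
      leaf∧b⇒nonRoot w t = from T-∧ (leaf⇒nonRoot 2≤n (proj₁ (to (T-∧ {isLeaf w}) t)) , t)

    ∣B∣≤1+children : ∣ B ∣ ≤ suc (∑[ p < n ] childCount p b)
    ∣B∣≤1+children = begin
      ∣ B ∣                                             ≡⟨ ∣p∣≡count B ⟩
      count b                                           ≡⟨ count-split b root ⟩
      ⟦ b root ⟧ + count (λ u → nonRoot u ∧ b u)        ≤⟨ +-monoˡ-≤ _ (⟦⟧≤1 (b root)) ⟩
      suc (count (λ u → nonRoot u ∧ b u))               ≡⟨ cong suc (∑-childCount b) ⟨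
      suc (∑[ p < n ] childCount p b)                   ∎
      where open ≤-Reasoning

    2∣B∣≤1+nonLeaves+s : 2 ≤ n → ∣ B ∣ + ∣ B ∣ ≤ suc ((n ∸ ℓ) + s)
    2∣B∣≤1+nonLeaves+s 2≤n = begin
      ∣ B ∣ + ∣ B ∣
        ≡⟨ cong (_+ ∣ B ∣) (∣p∣≡count B) ⟩
      count b + ∣ B ∣
        ≤⟨ +-monoʳ-≤ (count b) ∣B∣≤1+children ⟩
      count b + suc (∑[ p < n ] childCount p b)
        ≡⟨ +-suc (count b) _ ⟩
      suc (count b + ∑[ p < n ] childCount p b)
        ≡⟨ cong suc (∑-distrib-+ (⟦_⟧ ∘ b) (λ p → childCount p b)) ⟨
      suc (∑[ w < n ] (⟦ b w ⟧ + childCount w b))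
        ≤⟨ s≤s (∑-mono-≤ self+children≤nonLeaf+leafInB) ⟩
      suc (∑[ w < n ] (⟦ not (isLeaf w) ⟧ + ⟦ isLeaf w ∧ b w ⟧))
        ≡⟨ cong suc (∑-distrib-+ (⟦_⟧ ∘ not ∘ isLeaf) _) ⟩
      suc (count (not ∘ isLeaf) + count (λ w → isLeaf w ∧ b w))
        ≤⟨ s≤s (+-mono-≤ (≤-reflexive nonLeaves) (leaves∩B≤s 2≤n)) ⟩
      suc ((n ∸ ℓ) + s) ∎
      where
      open ≤-Reasoning
      nonLeaves : count (not ∘ isLeaf) ≡ n ∸ ℓ
      nonLeaves = trans (count-not isLeaf) (cong (n ∸_) (sym (∣tabulate∣≡count isLeaf)))

  chosenLeaf : Fin n → Maybe (Fin n)
  chosenLeaf p with any? (λ u → T? (arc? p u ∧ isLeaf u))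
  ... | yes (u , _) = just u
  ... | no  _       = nothing

  chosenLeaf-sound : ∀ {p u} → chosenLeaf p ≡ just u → T (arc? p u ∧ isLeaf u)
  chosenLeaf-sound {p} eq with any? (λ u → T? (arc? p u ∧ isLeaf u))
  chosenLeaf-sound {p} refl | yes (u , t) = t

  chosenLeaf-complete : ∀ {p} → T (isSupport p) → ∃ λ u → chosenLeaf p ≡ just u
  chosenLeaf-complete {p} supp with any? (λ u → T? (arc? p u ∧ isLeaf u))
  ... | yes (u , _) = u , refl
  ... | no  none    = ⊥-elim (none (support⇒leafChild supp))

  chosenLeaves : Subset n
  chosenLeaves = tabulate λ u → does (≡-dec _≟_ (chosenLeaf (par u)) (just u))

  chosen⁻ : ∀ {u} → T (lookup chosenLeaves u) → chosenLeaf (par u) ≡ just u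
  chosen⁻ {u} t = does⁻ (≡-dec _≟_ _ _) (subst T (lookup∘tabulate _ u) t)

  chosen⁺ : ∀ {u} → chosenLeaf (par u) ≡ just u → T (lookup chosenLeaves u)
  chosen⁺ {u} eq = subst T (sym (lookup∘tabulate _ u)) (does⁺ (≡-dec _≟_ _ _) eq)

  chosenChild⁻ : ∀ {p u} → T (arc? p u ∧ lookup chosenLeaves u) → chosenLeaf p ≡ just u
  chosenChild⁻ {p} {u} t = let arc , chosen = to (T-∧ {arc? p u}) t in
    subst (λ q → chosenLeaf q ≡ just u) (proj₂ (arc?⇒Arc arc)) (chosen⁻ chosen)

  chosenChild⁺ : ∀ {p u} → chosenLeaf p ≡ just u → T (arc? p u ∧ lookup chosenLeaves u)
  chosenChild⁺ {p} {u} eq = let arc = proj₁ (to (T-∧ {arc? p u}) (chosenLeaf-sound eq)) in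
    from T-∧ (arc , chosen⁺ (subst (λ q → chosenLeaf q ≡ just u) (sym (proj₂ (arc?⇒Arc arc))) eq))

  chosen+children≤1 : ∀ v → ⟦ lookup chosenLeaves v ⟧ + childCount v (lookup chosenLeaves) ≤ 1
  chosen+children≤1 v with lookup chosenLeaves v in v-chosen
  ... | true  = ≤-reflexive (cong suc (leaf⇒childCount≡0 v-leaf (lookup chosenLeaves)))
    where
    v-leaf = proj₂ (to (T-∧ {arc? (par v) v}) (chosenLeaf-sound (chosen⁻ (from T-≡ v-chosen))))
  ... | false = count≤1 _ λ u u′ t t′ → just-injective (trans (sym (chosenChild⁻ t)) (chosenChild⁻ t′))

  chosenLeaves-packing : IsPacking chosenLeaves
  chosenLeaves-packing v = subst (_≤ 1) (sym (∣N⁺∩∣≡self+children v chosenLeaves)) (chosen+children≤1 v)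

  s≤∣chosenLeaves∣ : s ≤ ∣ chosenLeaves ∣
  s≤∣chosenLeaves∣ = begin
    s                                      ≡⟨ ∣tabulate∣≡count isSupport ⟩
    count isSupport                        ≤⟨ ∑-mono-≤ support≤chosenChildren ⟩
    ∑[ p < n ] childCount p chosen         ≡⟨ ∑-childCount chosen ⟩
    count (λ u → nonRoot u ∧ chosen u)     ≤⟨ count-mono (λ u → proj₂ ∘ to (T-∧ {nonRoot u})) ⟩
    count chosen                           ≡⟨ ∣p∣≡count chosenLeaves ⟨
    ∣ chosenLeaves ∣                       ∎
    where
    open ≤-Reasoning
    chosen = lookup chosenLeaves
    support≤chosenChildren : ∀ p → ⟦ isSupport p ⟧ ≤ childCount p chosen
    support≤chosenChildren p with isSupport p in supp
    ... | false = z≤n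
    ... | true  = T⇒1≤count (λ u → arc? p u ∧ chosen u)
                            (chosenChild⁺ (proj₂ (chosenLeaf-complete (from T-≡ supp))))

theorem6 : (n : ℕ) → 2 ≤ n → (T : RootedTree n) → (ρ : ℕ) →
    RootedTree.IsPackingNumber T ρ →
    (RootedTree.s T ≤ ρ) × (ρ ≤ ⌈ (n ∸ RootedTree.ℓ T) + RootedTree.s T /2⌉)
theorem6 n 2≤n tree ρ ((B , packing , ∣B∣≡ρ) , maximum) =
  ≤-trans (s≤∣chosenLeaves∣ tree) (maximum (chosenLeaves tree) (chosenLeaves-packing tree)) ,
  subst (_≤ _) ∣B∣≡ρ (2k≤1+m⇒k≤⌈m/2⌉ (2∣B∣≤1+nonLeaves+s tree packing 2≤n))
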